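{- For every set of formulas $\Gamma$ and formula $\alpha$: $\circ^*(\mathrm{Var}(\Gamma\cup\{\alpha\})),\Gamma\vdash_{LFI3}\alpha$ if and only if $\Gamma\vdash_{CPL}\alpha$.
   Context: Formulas are built from propositional variables using unary $\neg,\circ$ and binary $\land,\lor,\to$. Define $\circ^*\alpha:=(\alpha\land\circ\alpha\land\circ\circ\alpha)\lor(\neg\alpha\land\circ\alpha\land\circ\circ\alpha)$. $\mathrm{Var}(\Delta)$ is the set of variables occurring in $\Delta$ and $\circ^*(X)=\{\circ^*p:p\in X\}$. LFI3 is the logic of the 5-valued matrix: with Boolean $\land,\lor,\to,\sim$ on $\{0,1\}$, domain $\{T=(1,0,0),t=(1,0,1),b=(1,1,1),f=(0,1,1),F=(0,1,0)\}$, designated $\{T,t,b\}$, operations $a\dot\land b=(a_1\land b_1,a_2\lor b_2,(\sim a_2\land b_3)\lor(a_3\land\sim b_2)\lor(a_3\land b_3))$, $a\dot\lor b=(a_1\lor b_1,a_2\land b_2,(\sim a_1\land b_3)\lor(a_3\land\sim b_1)\lor(a_3\land b_3))$, $a\dot\to b=(a_1\to b_1,b_2\land(\sim a_2\lor a_3),(\sim a_2\land b_3)\lor(\sim a_2\land a_3\land\sim b_1)\lor(a_3\land b_3)\lor(\sim a_1\land a_3\land\sim b_1))$, $\dot\neg a=(a_2,a_1,a_3)$, $\dot\circ a=(\sim(a_1\land a_2),a_3,a_3\land\sim(a_1\land a_2))$. CPL is classical logic over this signature: the matrix on the subalgebra $\{T,F\}$ with designated set $\{T\}$ (Boolean $\neg,\land,\lor,\to$,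 and $\circ$ constantly $T$). For a matrix, valuations are homomorphisms from formulas and $\Gamma\vdash\alpha$ iff every valuation designating all of $\Gamma$ designates $\alpha$. -}

module Defs where

open import Data.Nat using (ℕ)
open import Data.Bool using (Bool; true; false; _∧_; _∨_; not)
open import Data.Product using (_×_; _,_; Σ; ∃)
open import Data.Sum using (_⊎_)
open import Relation.Binary.PropositionalEquality using (_≡_)

data Formula : Set where
  var  : ℕ → Formula
  ¬'_  : Formula → Formula
  ∘'_  : Formula → Formula
  _∧'_ : Formula → Formula → Formula
  _∨'_ : Formula → Formula → Formula
  _⇒'_ : Formula → Formula → Formula

∘* : Formula → Formula
∘* α = ((α ∧' (∘' α)) ∧' (∘' (∘' α))) ∨' (((¬' α) ∧' (∘' α)) ∧' (∘' (∘' α)))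

data _occursIn_ (p : ℕ) : Formula → Set where
  here : p occursIn var p
  ¬occ : ∀ {a} → p occursIn a → p occursIn (¬' a)
  ∘occ : ∀ {a} → p occursIn a → p occursIn (∘' a)
  ∧l : ∀ {a b} → p occursIn a → p occursIn (a ∧' b)
  ∧r : ∀ {a b} → p occursIn b → p occursIn (a ∧' b)
  ∨l : ∀ {a b} → p occursIn a → p occursIn (a ∨' b)
  ∨r : ∀ {a b} → p occursIn b → p occursIn (a ∨' b)
  ⇒l : ∀ {a b} → p occursIn a → p occursIn (a ⇒' b)
  ⇒r : ∀ {a b} → p occursIn b → p occursIn (a ⇒' b)

FSet : Set₁
FSet = Formula → Set

VarOf : FSet → Formula → ℕ → Set
VarOf Γ α p = p occursIn α ⊎ ∃ λ γ → Γ γ × p occursIn γ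

LFI3Premises : FSet → Formula → FSet
LFI3Premises Γ α φ = (∃ λ p → VarOf Γ α p × φ ≡ ∘* (var p)) ⊎ Γ φ

_⊃_ : Bool → Bool → Bool
a ⊃ b = not a ∨ b

Triple : Set
Triple = Bool × Bool × Bool

-- The operations of the 5-valued matrix, on triples
_∧̇_ : Triple → Triple → Triple
(a1 , a2 , a3) ∧̇ (b1 , b2 , b3) =
  (a1 ∧ b1) , (a2 ∨ b2) ,
  (((not a2 ∧ b3) ∨ (a3 ∧ not b2)) ∨ (a3 ∧ b3))

_∨̇_ : Triple → Triple → Triple
(a1 , a2 , a3) ∨̇ (b1 , b2 , b3) =
  (a1 ∨ b1) , (a2 ∧ b2) ,
  (((not a1 ∧ b3) ∨ (a3 ∧ not b1)) ∨ (a3 ∧ b3))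

_→̇_ : Triple → Triple → Triple
(a1 , a2 , a3) →̇ (b1 , b2 , b3) =
  (a1 ⊃ b1) , (b2 ∧ (not a2 ∨ a3)) ,
  ((((not a2 ∧ b3) ∨ ((not a2 ∧ a3) ∧ not b1)) ∨ (a3 ∧ b3))
     ∨ ((not a1 ∧ a3) ∧ not b1))

¬̇ : Triple → Triple
¬̇ (a1 , a2 , a3) = a2 , a1 , a3

∘̇ : Triple → Triple
∘̇ (a1 , a2 , a3) = not (a1 ∧ a2) , a3 , (a3 ∧ not (a1 ∧ a2))

data V5 : Set where
  T t b f F : V5

⟦_⟧ : V5 → Triple
⟦ T ⟧ = true , false , false
⟦ t ⟧ = true , false , true
⟦ b ⟧ = true , true , true
⟦ f ⟧ = false , true , true
⟦ F ⟧ = false , true , false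

eval : (ℕ → Triple) → Formula → Triple
eval v (var p)  = v p
eval v (¬' a)   = ¬̇ (eval v a)
eval v (∘' a)   = ∘̇ (eval v a)
eval v (a ∧' c) = eval v a ∧̇ eval v c
eval v (a ∨' c) = eval v a ∨̇ eval v c
eval v (a ⇒' c) = eval v a →̇ eval v c

DesignatedLFI3 : Triple → Set
DesignatedLFI3 x = x ≡ ⟦ T ⟧ ⊎ x ≡ ⟦ t ⟧ ⊎ x ≡ ⟦ b ⟧

_⊢LFI3_ : FSet → Formula → Set
Γ ⊢LFI3 α = (v : ℕ → V5) →
  (∀ γ → Γ γ → DesignatedLFI3 (eval (λ p → ⟦ v p ⟧) γ)) →
  DesignatedLFI3 (eval (λ p → ⟦ v p ⟧) α)

-- CPL: valuations into the subalgebra {T, F}, designated {T}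
TF : Bool → Triple
TF true  = ⟦ T ⟧
TF false = ⟦ F ⟧

DesignatedCPL : Triple → Set
DesignatedCPL x = x ≡ ⟦ T ⟧

_⊢CPL_ : FSet → Formula → Set
Γ ⊢CPL α = (v : ℕ → Bool) →
  (∀ γ → Γ γ → DesignatedCPL (eval (λ p → TF (v p)) γ)) →
  DesignatedCPL (eval (λ p → TF (v p)) α)

{-# OPTIONS --safe #-}
module Submission where

-- {T, F} is a subalgebra of the LFI3 matrix on which the operations and the
-- designated set are the classical ones, so every CPL valuation is an LFI3
-- valuation; it satisfies every ∘*p because ∘* is designated exactly on {T, F}.
-- Conversely, an LFI3 valuation designating ∘*p for every variable p of Γ ∪ {α}
-- sends those variables into {T, F}, hence agrees on Γ ∪ {α} with a CPL valuation.

open import Defs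
open import Data.Bool using (Bool; true; false; _∧_; _∨_; not)
open import Data.Nat using (ℕ)
open import Data.Product using (_,_)
open import Data.Sum using (inj₁; inj₂)
open import Function using (_∘_)
open import Function.Bundles using (_⇔_; mk⇔)
open import Relation.Binary.PropositionalEquality using (_≡_; refl; sym; trans; cong; cong₂; subst)

evalᶜ : (ℕ → Bool) → Formula → Bool
evalᶜ u (var p)  = u p
evalᶜ u (¬' φ)   = not (evalᶜ u φ)
evalᶜ u (∘' φ)   = true
evalᶜ u (φ ∧' ψ) = evalᶜ u φ ∧ evalᶜ u ψ
evalᶜ u (φ ∨' ψ) = evalᶜ u φ ∨ evalᶜ u ψ
evalᶜ u (φ ⇒' ψ) = evalᶜ u φ ⊃ evalᶜ u ψ

¬̇-TF : ∀ c → ¬̇ (TF c) ≡ TF (not c)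
¬̇-TF true  = refl
¬̇-TF false = refl

∘̇-TF : ∀ c → ∘̇ (TF c) ≡ TF true
∘̇-TF true  = refl
∘̇-TF false = refl

∧̇-TF : ∀ c d → TF c ∧̇ TF d ≡ TF (c ∧ d)
∧̇-TF true  true  = refl
∧̇-TF true  false = refl
∧̇-TF false true  = refl
∧̇-TF false false = refl

∨̇-TF : ∀ c d → TF c ∨̇ TF d ≡ TF (c ∨ d)
∨̇-TF true  true  = refl
∨̇-TF true  false = refl
∨̇-TF false true  = refl
∨̇-TF false false = refl

→̇-TF : ∀ c d → TF c →̇ TF d ≡ TF (c ⊃ d)
→̇-TF true  true  = refl
→̇-TF true  false = refl
→̇-TF false true  = refl
→̇-TF false false = refl

eval-TF : ∀ u φ → eval (TF ∘ u) φ ≡ TF (evalᶜ u φ)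
eval-TF u (var p)  = refl
eval-TF u (¬' φ)   = trans (cong ¬̇ (eval-TF u φ)) (¬̇-TF (evalᶜ u φ))
eval-TF u (∘' φ)   = trans (cong ∘̇ (eval-TF u φ)) (∘̇-TF (evalᶜ u φ))
eval-TF u (φ ∧' ψ) = trans (cong₂ _∧̇_ (eval-TF u φ) (eval-TF u ψ)) (∧̇-TF (evalᶜ u φ) (evalᶜ u ψ))
eval-TF u (φ ∨' ψ) = trans (cong₂ _∨̇_ (eval-TF u φ) (eval-TF u ψ)) (∨̇-TF (evalᶜ u φ) (evalᶜ u ψ))
eval-TF u (φ ⇒' ψ) = trans (cong₂ _→̇_ (eval-TF u φ) (eval-TF u ψ)) (→̇-TF (evalᶜ u φ) (evalᶜ u ψ))

designated-TF : ∀ c → DesignatedLFI3 (TF c) → DesignatedCPL (TF c)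
designated-TF true  _                = refl
designated-TF false (inj₁ ())
designated-TF false (inj₂ (inj₁ ()))
designated-TF false (inj₂ (inj₂ ()))

designated-eval-TF : ∀ u φ → DesignatedLFI3 (eval (TF ∘ u) φ) → DesignatedCPL (eval (TF ∘ u) φ)
designated-eval-TF u φ rewrite eval-TF u φ = designated-TF (evalᶜ u φ)

eval-cong : ∀ {v w : ℕ → Triple} φ → (∀ p → p occursIn φ → v p ≡ w p) → eval v φ ≡ eval w φ
eval-cong (var p)  eq = eq p here
eval-cong (¬' φ)   eq = cong ¬̇ (eval-cong φ (λ p → eq p ∘ ¬occ))
eval-cong (∘' φ)   eq = cong ∘̇ (eval-cong φ (λ p → eq p ∘ ∘occ))
eval-cong (φ ∧' ψ) eq = cong₂ _∧̇_ (eval-cong φ (λ p → eq p ∘ ∧l)) (eval-cong ψ (λ p → eq p ∘ ∧r))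
eval-cong (φ ∨' ψ) eq = cong₂ _∨̇_ (eval-cong φ (λ p → eq p ∘ ∨l)) (eval-cong ψ (λ p → eq p ∘ ∨r))
eval-cong (φ ⇒' ψ) eq = cong₂ _→̇_ (eval-cong φ (λ p → eq p ∘ ⇒l)) (eval-cong ψ (λ p → eq p ∘ ⇒r))

fromBool : Bool → V5
fromBool true  = T
fromBool false = F

⟦fromBool⟧ : ∀ c → ⟦ fromBool c ⟧ ≡ TF c
⟦fromBool⟧ true  = refl
⟦fromBool⟧ false = refl

⊢LFI3⇒⊢CPL : ∀ Γ α → Γ ⊢LFI3 α → Γ ⊢CPL α
⊢LFI3⇒⊢CPL Γ α ⊢α u ⊨Γ =
  designated-eval-TF u α (subst DesignatedLFI3 (eval-fromBool α) (⊢α (fromBool ∘ u) ⊨Γ′))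
  where
  eval-fromBool : ∀ φ → eval (⟦_⟧ ∘ fromBool ∘ u) φ ≡ eval (TF ∘ u) φ
  eval-fromBool φ = eval-cong φ (λ p _ → ⟦fromBool⟧ (u p))

  ⊨Γ′ : ∀ γ → Γ γ → DesignatedLFI3 (eval (⟦_⟧ ∘ fromBool ∘ u) γ)
  ⊨Γ′ γ γ∈Γ = subst DesignatedLFI3 (sym (eval-fromBool γ)) (inj₁ (⊨Γ γ γ∈Γ))

∘*̇ : Triple → Triple
∘*̇ x = ((x ∧̇ ∘̇ x) ∧̇ ∘̇ (∘̇ x)) ∨̇ ((¬̇ x ∧̇ ∘̇ x) ∧̇ ∘̇ (∘̇ x))

∘*̇-TF : ∀ c → ∘*̇ (TF c) ≡ ⟦ T ⟧
∘*̇-TF true  = refl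
∘*̇-TF false = refl

⊢CPL-drop-∘* : ∀ Γ α → LFI3Premises Γ α ⊢CPL α → Γ ⊢CPL α
⊢CPL-drop-∘* Γ α ⊢α u ⊨Γ = ⊢α u λ where
  _ (inj₁ (p , _ , refl)) → ∘*̇-TF (u p)
  γ (inj₂ γ∈Γ)            → ⊨Γ γ γ∈Γ

toBool : V5 → Bool
toBool T = true
toBool _ = false

∘*̇-designated⇒TF : ∀ x → DesignatedLFI3 (∘*̇ ⟦ x ⟧) → ⟦ x ⟧ ≡ TF (toBool x)
∘*̇-designated⇒TF T _ = refl
∘*̇-designated⇒TF F _ = refl
∘*̇-designated⇒TF t (inj₁ ())
∘*̇-designated⇒TF t (inj₂ (inj₁ ()))
∘*̇-designated⇒TF t (inj₂ (inj₂ ()))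
∘*̇-designated⇒TF b (inj₁ ())
∘*̇-designated⇒TF b (inj₂ (inj₁ ()))
∘*̇-designated⇒TF b (inj₂ (inj₂ ()))
∘*̇-designated⇒TF f (inj₁ ())
∘*̇-designated⇒TF f (inj₂ (inj₁ ()))
∘*̇-designated⇒TF f (inj₂ (inj₂ ()))

∘*-designated⇒eval-classical : ∀ (v : ℕ → V5) φ → (∀ p → p occursIn φ → DesignatedLFI3 (∘*̇ ⟦ v p ⟧)) →
  eval (⟦_⟧ ∘ v) φ ≡ eval (TF ∘ toBool ∘ v) φ
∘*-designated⇒eval-classical v φ ⊨∘* = eval-cong φ (λ p p∈φ → ∘*̇-designated⇒TF (v p) (⊨∘* p p∈φ))

⊢CPL⇒⊢LFI3-∘* : ∀ Γ α → Γ ⊢CPL α → LFI3Premises Γ α ⊢LFI3 α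
⊢CPL⇒⊢LFI3-∘* Γ α ⊢α v ⊨Δ =
  subst DesignatedLFI3 (sym (classical-on α inj₁)) (inj₁ (⊢α (toBool ∘ v) ⊨Γ))
  where
  classical-on : ∀ φ → (∀ {p} → p occursIn φ → VarOf Γ α p) →
    eval (⟦_⟧ ∘ v) φ ≡ eval (TF ∘ toBool ∘ v) φ
  classical-on φ vars = ∘*-designated⇒eval-classical v φ (λ p p∈φ → ⊨Δ (∘* (var p)) (inj₁ (p , vars p∈φ , refl)))

  ⊨Γ : ∀ γ → Γ γ → DesignatedCPL (eval (TF ∘ toBool ∘ v) γ)
  ⊨Γ γ γ∈Γ = designated-eval-TF (toBool ∘ v) γ
    (subst DesignatedLFI3 (classical-on γ (λ p∈γ → inj₂ (γ , γ∈Γ , p∈γ))) (⊨Δ γ (inj₂ γ∈Γ)))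

theorem21 : (Γ : FSet) (α : Formula) →
    (LFI3Premises Γ α ⊢LFI3 α) ⇔ (Γ ⊢CPL α)
theorem21 Γ α = mk⇔ (⊢CPL-drop-∘* Γ α ∘ ⊢LFI3⇒⊢CPL (LFI3Premises Γ α) α) (⊢CPL⇒⊢LFI3-∘* Γ α)
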